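{- For every positive integer $k$, with $n=2k$, one has $\tau(n)\ge k-1+\tau(k)$.
   Context: Multi-pass stack sorting: in a pass, the entries of the current input are pushed one at a time, in order, onto a stack; whenever the top of the stack is the smallest value not yet output, it is popped to the output (repeatedly); entries are never popped otherwise. When all input entries have been pushed and no pop is possible, if the stack is nonempty the remaining entries are returned to the input in their original relative order and a new pass begins. The tier $t(\sigma)$ of a permutation $\sigma$ is one less than the minimum number of passes needed to output $1,\dots,n$. For a positive integer $n$, $\tau(n)$ denotes the maximum of $t(\sigma)$ over all permutations $\sigma$ of length $n$. -}

module Defs where

open import Data.Nat using (ℕ; zero; suc; _+_; _∸_; _≟_)
open import Data.List using (List; []; _∷_; _++_; reverse; map; upTo; concatMap; length)
open import Data.List.Extrema.Nat using (max)
open import Data.Product using (_×_; _,_)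
open import Relation.Nullary using (yes; no)

-- Permutations of length n are represented in one-line notation as lists
-- containing each of 1,…,n exactly once.

insertions : ℕ → List ℕ → List (List ℕ)
insertions x []       = (x ∷ []) ∷ []
insertions x (y ∷ ys) = (x ∷ y ∷ ys) ∷ map (y ∷_) (insertions x ys)

perms : List ℕ → List (List ℕ)
perms []       = [] ∷ []
perms (x ∷ xs) = concatMap (insertions x) (perms xs)

oneTo : ℕ → List ℕ
oneTo n = map suc (upTo n)

Perms : ℕ → List (List ℕ)
Perms n = perms (oneTo n)

-- One pass of stack sorting.
-- State: `next` is the smallest value not yet output; `stack` is the
-- stack (head = top).

popAll : ℕ → List ℕ → ℕ × List ℕ
popAll next []       = next , []
popAll next (s ∷ st) with s ≟ next
... | yes _ = popAll (suc next) st
... | no  _ = next , s ∷ st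

runPass : ℕ → List ℕ → List ℕ → ℕ × List ℕ
runPass next stack []       = next , stack
runPass next stack (x ∷ xs) with popAll next (x ∷ stack)
... | next' , stack' = runPass next' stack' xs

-- one full pass on an input, given the smallest value not yet output;
-- returns the new smallest-not-yet-output value and the new input
-- (the remaining stack entries in their original relative order, i.e.
-- bottom-to-top of the stack).
pass : ℕ → List ℕ → ℕ × List ℕ
pass next input with runPass next [] input
... | next' , stack = next' , reverse stack

-- number of passes performed until the input is exhausted, with fuel.
-- (Each pass outputs at least one entry, so fuel = length suffices.)
passesAux : ℕ → ℕ → List ℕ → ℕ
passesAux fuel       next []        = 0
passesAux zero       next (x ∷ xs)  = 0
passesAux (suc fuel) next (x ∷ xs) with pass next (x ∷ xs)
... | next' , rest = suc (passesAux fuel next' rest)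

passes : List ℕ → ℕ
passes σ = passesAux (length σ) 1 σ

tier : List ℕ → ℕ
tier σ = passes σ ∸ 1

τ : ℕ → ℕ
τ n = max 0 (map tier (Perms n))

-- Interleave a permutation σ of length k, shifted up by k, with the markers k, k−1, …, 1:
-- π = (k+σ₁) k (k+σ₂) (k−1) … (k+σₖ) 1.  In each of the first k − 1 passes the only entry
-- output is the smallest marker: everything before it is pushed without popping, and popping
-- it exposes a larger shifted entry.  What is left is (k+σ₁) k (k+σ₂) … (k+σₖ); in the next
-- pass k+σ₁ is pushed and k popped, which is the first pass on σ translated by k, and passes
-- commute with translation.  So π needs (k − 1) + passes(σ) passes.

module Submission where

open import Defs
open import Data.Nat using (ℕ; zero; suc; _+_; _*_; _∸_; _≤_; _≥_; _<_; _≟_; z≤n; s≤s)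
open import Data.Nat.Properties
open import Data.List using (List; []; _∷_; _++_; _∷ʳ_; _ʳ++_; [_]; reverse; map; length; upTo; applyDownFrom)
open import Data.List.Properties
  using (++-assoc; ++-identityʳ; ʳ++-ʳ++; reverse-map; length-++; length-map; length-upTo; map-id;
         map-upTo; reverse-applyUpTo)
open import Data.List.Relation.Unary.Any using (here; there)
open import Data.List.Membership.Propositional using (_∈_; find; lose)
open import Data.List.Membership.Propositional.Properties
  using (∈-map⁺; ∈-map⁻; ∈-concatMap⁺; ∈-concatMap⁻; ∈-∃++)
open import Data.List.Relation.Binary.Permutation.Propositional
  using (_↭_; prep; swap; ↭-refl; ↭-sym; ↭-trans; ↭-reflexive; module PermutationReasoning)
import Data.List.Relation.Binary.Permutation.Propositional.Properties as ↭
open import Data.List.Extrema.Nat using (max; max≤v⁺; xs≤max)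
open import Data.List.Relation.Unary.All as All using (All; []; _∷_)
import Data.List.Relation.Unary.All.Properties as All
open import Data.List.Reverse using (Reverse; []; _∶_∶ʳ_; reverseView)
open import Data.Product using (_×_; _,_; proj₁; proj₂; uncurry)
open import Function using (_∘_)
open import Relation.Nullary using (yes; no; contradiction)
open import Relation.Binary.PropositionalEquality
  using (_≡_; _≢_; refl; sym; trans; cong; cong₂; subst; module ≡-Reasoning)

popAll-pop : ∀ n st → popAll n (n ∷ st) ≡ popAll (suc n) st
popAll-pop n st with n ≟ n
... | yes _  = refl
... | no n≢n = contradiction refl n≢n

popAll-stop : ∀ {n s} st → s ≢ n → popAll n (s ∷ st) ≡ (n , s ∷ st)
popAll-stop {n} {s} st s≢n with s ≟ n
... | yes s≡n = contradiction s≡n s≢n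
... | no _    = refl

shift : ℕ → List ℕ → List ℕ
shift c = map (c +_)

shiftState : ℕ → ℕ × List ℕ → ℕ × List ℕ
shiftState c (n , st) = c + n , shift c st

popAll-shift : ∀ c n st → popAll (c + n) (shift c st) ≡ shiftState c (popAll n st)
popAll-shift c n []       = refl
popAll-shift c n (s ∷ st) with s ≟ n
... | yes refl = begin
  popAll (c + n) (c + n ∷ shift c st) ≡⟨ popAll-pop (c + n) (shift c st) ⟩
  popAll (suc (c + n)) (shift c st)   ≡⟨ cong (λ m → popAll m (shift c st)) (sym (+-suc c n)) ⟩
  popAll (c + suc n) (shift c st)     ≡⟨ popAll-shift c (suc n) st ⟩
  shiftState c (popAll (suc n) st)    ∎
  where open ≡-Reasoning
... | no s≢n = popAll-stop (shift c st) (s≢n ∘ +-cancelˡ-≡ c s n)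

runPass-shift : ∀ c n st xs →
  runPass (c + n) (shift c st) (shift c xs) ≡ shiftState c (runPass n st xs)
runPass-shift c n st []       = refl
runPass-shift c n st (x ∷ xs) rewrite popAll-shift c n (x ∷ st) = runPass-shift c _ _ xs

pass-shift-runPass : ∀ {c} n xs m ys →
  runPass n [] xs ≡ shiftState c (runPass m [] ys) → pass n xs ≡ shiftState c (pass m ys)
pass-shift-runPass {c} n xs m ys eq rewrite eq =
  cong (c + proj₁ (runPass m [] ys) ,_) (sym (reverse-map (c +_) (proj₂ (runPass m [] ys))))

pass-shift : ∀ c n xs → pass (c + n) (shift c xs) ≡ shiftState c (pass n xs)
pass-shift c n xs = pass-shift-runPass (c + n) (shift c xs) n xs (runPass-shift c n [] xs)

passesAux-suc : ∀ f n x xs {n′ rest} → pass n (x ∷ xs) ≡ (n′ , rest) →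
  passesAux (suc f) n (x ∷ xs) ≡ suc (passesAux f n′ rest)
passesAux-suc f n x xs eq = cong (λ p → suc (passesAux f (proj₁ p) (proj₂ p))) eq

passesAux-shift : ∀ f c n xs → passesAux f (c + n) (shift c xs) ≡ passesAux f n xs
passesAux-shift f       c n []       = refl
passesAux-shift zero    c n (x ∷ xs) = refl
passesAux-shift (suc f) c n (x ∷ xs) =
  trans (passesAux-suc f (c + n) (c + x) (shift c xs) (pass-shift c n (x ∷ xs)))
        (cong suc (passesAux-shift f c _ _))

passesAux-mono-fuel : ∀ f n xs → passesAux f n xs ≤ passesAux (suc f) n xs
passesAux-mono-fuel f       n []       = z≤n
passesAux-mono-fuel zero    n (x ∷ xs) = z≤n
passesAux-mono-fuel (suc f) n (x ∷ xs) = s≤s (passesAux-mono-fuel f _ _)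

runPass-++ : ∀ n st xs ys →
  runPass n st (xs ++ ys) ≡ uncurry (λ n′ st′ → runPass n′ st′ ys) (runPass n st xs)
runPass-++ n st []       ys = refl
runPass-++ n st (x ∷ xs) ys = runPass-++ _ _ xs ys

runPass-push : ∀ {n} st xs → All (n <_) xs → runPass n st xs ≡ (n , xs ʳ++ st)
runPass-push st []       []         = refl
runPass-push st (x ∷ xs) (n<x ∷ ns) rewrite popAll-stop st (>⇒≢ n<x) =
  runPass-push (x ∷ st) xs ns

pass-removes-next : ∀ {n a} P Q → All (n <_) P → suc n < a → All (suc n <_) Q →
  pass n (P ++ a ∷ n ∷ Q) ≡ (suc n , P ++ a ∷ Q)
pass-removes-next {n} {a} P Q nP na nQ
  rewrite runPass-++ n [] P (a ∷ n ∷ Q) | runPass-push [] P nP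
        | popAll-stop (P ʳ++ []) (>⇒≢ (<-trans (n<1+n n) na))
        | popAll-pop n (a ∷ P ʳ++ []) | popAll-stop (P ʳ++ []) (>⇒≢ na)
        | runPass-push (a ∷ P ʳ++ []) Q nQ
  = cong (suc n ,_) (begin
      reverse (Q ʳ++ a ∷ P ʳ++ [])   ≡⟨ ʳ++-ʳ++ Q ⟩
      (a ∷ P ʳ++ []) ʳ++ Q ++ []     ≡⟨ ʳ++-ʳ++ P ⟩
      P ++ a ∷ Q ++ []               ≡⟨ cong (λ l → P ++ a ∷ l) (++-identityʳ Q) ⟩
      P ++ a ∷ Q                     ∎)
  where open ≡-Reasoning

pass-head-shift : ∀ c {y} bs → 0 < y →
  pass c (c + y ∷ c ∷ shift c bs) ≡ shiftState c (pass 1 (y ∷ bs))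
pass-head-shift c {y} bs 0<y = pass-shift-runPass c (c + y ∷ c ∷ shift c bs) 1 (y ∷ bs) (begin
  runPass c [] (c + y ∷ c ∷ shift c bs)
    ≡⟨ cong (λ p → runPass (proj₁ p) (proj₂ p) (c ∷ shift c bs)) (popAll-stop [] c+y≢c) ⟩
  runPass c (c + y ∷ []) (c ∷ shift c bs)
    ≡⟨ cong (λ p → runPass (proj₁ p) (proj₂ p) (shift c bs)) (begin
         popAll c (c ∷ c + y ∷ [])     ≡⟨ popAll-pop c (c + y ∷ []) ⟩
         popAll (suc c) (c + y ∷ [])   ≡⟨ cong (λ n → popAll n (c + y ∷ [])) (+-comm 1 c) ⟩
         popAll (c + 1) (c + y ∷ [])   ≡⟨ popAll-shift c 1 (y ∷ []) ⟩
         shiftState c (popAll 1 (y ∷ [])) ∎) ⟩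
  runPass (c + proj₁ (popAll 1 (y ∷ []))) (shift c (proj₂ (popAll 1 (y ∷ [])))) (shift c bs)
    ≡⟨ runPass-shift c _ _ bs ⟩
  shiftState c (runPass 1 [] (y ∷ bs)) ∎)
  where
  open ≡-Reasoning
  c+y≢c : c + y ≢ c
  c+y≢c = >⇒≢ (m<m+n c 0<y)

passesAux-head-shift : ∀ f c {y} bs → 0 < y →
  passesAux f c (c + y ∷ c ∷ shift c bs) ≡ passesAux f 1 (y ∷ bs)
passesAux-head-shift zero    c bs 0<y = refl
passesAux-head-shift (suc f) c {y} bs 0<y =
  trans (passesAux-suc f c (c + y) (c ∷ shift c bs) (pass-head-shift c bs 0<y))
        (cong suc (passesAux-shift f c _ _))

-- weave c j (x₁ ∷ … ∷ xₘ) = (c+x₁) (j+m) (c+x₂) (j+m−1) … (c+xₘ) (j+1)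
weave : ℕ → ℕ → List ℕ → List ℕ
weave c j []       = []
weave c j (x ∷ xs) = c + x ∷ suc (length xs + j) ∷ weave c j xs

length-∷ʳ : ∀ xs (z : ℕ) → length (xs ∷ʳ z) ≡ suc (length xs)
length-∷ʳ xs z = trans (length-++ xs) (+-comm (length xs) 1)

length-weave : ∀ c j xs → length (weave c j xs) ≡ length xs + length xs
length-weave c j []       = refl
length-weave c j (x ∷ xs) =
  cong suc (trans (cong suc (length-weave c j xs)) (sym (+-suc (length xs) (length xs))))

weave-∷ʳ : ∀ c j xs z → weave c j (xs ∷ʳ z) ≡ weave c (suc j) xs ++ c + z ∷ suc j ∷ []
weave-∷ʳ c j []       z = refl
weave-∷ʳ c j (x ∷ xs) z = cong₂ (λ m l → c + x ∷ suc m ∷ l)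
  (trans (cong (_+ j) (length-++ xs)) (+-assoc (length xs) 1 j)) (weave-∷ʳ c j xs z)

shift-above : ∀ {m c} xs → All (0 <_) xs → m ≤ c → All (m <_) (shift c xs)
shift-above []       []           m≤c = []
shift-above (x ∷ xs) (0<x ∷ 0<xs) m≤c = ≤-<-trans m≤c (m<m+n _ 0<x) ∷ shift-above xs 0<xs m≤c

weave-above : ∀ {j c} xs → All (0 <_) xs → j ≤ c → All (j <_) (weave c j xs)
weave-above []       []           j≤c = []
weave-above {j} (x ∷ xs) (0<x ∷ 0<xs) j≤c =
  ≤-<-trans j≤c (m<m+n _ 0<x) ∷ s≤s (m≤n+m j (length xs)) ∷ weave-above xs 0<xs j≤c

passesAux-weave : ∀ {xs} → Reverse xs → ∀ {c j} y bs f → length xs + suc j ≡ c →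
  All (0 <_) (y ∷ xs ++ bs) →
  passesAux (length xs + f) (suc j) (weave c j (y ∷ xs) ++ shift c bs)
    ≡ length xs + passesAux f 1 (y ∷ xs ++ bs)
passesAux-weave [] y bs f refl (0<y ∷ _) = passesAux-head-shift f _ bs 0<y
passesAux-weave (xs ∶ rxs ∶ʳ z) {c} {j} y bs f eq pos = begin
  passesAux (length (xs ∷ʳ z) + f) (suc j) (weave c j (y ∷ xs ∷ʳ z) ++ shift c bs)
    ≡⟨ cong₂ (λ g l → passesAux g (suc j) l) (cong (_+ f) (length-∷ʳ xs z)) layout ⟩
  passesAux (suc (length xs + f)) (suc j) (W ++ c + z ∷ suc j ∷ shift c bs)
    ≡⟨ passesAux-suc (length xs + f) (suc j) (c + y)
         (suc (length xs + suc j) ∷ weave c (suc j) xs ++ c + z ∷ suc j ∷ shift c bs)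
         (pass-removes-next W (shift c bs) (weave-above (y ∷ xs) 0<yxs (<⇒≤ 2+j≤c))
           (≤-<-trans 2+j≤c (m<m+n c 0<z)) (shift-above bs 0<bs 2+j≤c)) ⟩
  suc (passesAux (length xs + f) (suc (suc j)) (W ++ shift c (z ∷ bs)))
    ≡⟨ cong suc (passesAux-weave rxs y (z ∷ bs) f eq′ pos′) ⟩
  suc (length xs + passesAux f 1 (y ∷ xs ++ z ∷ bs))
    ≡⟨ cong₂ (λ m l → m + passesAux f 1 (y ∷ l))
             (sym (length-∷ʳ xs z)) (sym (++-assoc xs [ z ] bs)) ⟩
  length (xs ∷ʳ z) + passesAux f 1 (y ∷ (xs ∷ʳ z) ++ bs) ∎
  where
  open ≡-Reasoning
  W : List ℕ
  W = weave c (suc j) (y ∷ xs)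
  layout : weave c j (y ∷ xs ∷ʳ z) ++ shift c bs ≡ W ++ c + z ∷ suc j ∷ shift c bs
  layout = trans (cong (_++ shift c bs) (weave-∷ʳ c j (y ∷ xs) z)) (++-assoc W _ (shift c bs))
  eq′ : length xs + suc (suc j) ≡ c
  eq′ = trans (+-suc (length xs) (suc j)) (trans (cong (_+ suc j) (sym (length-∷ʳ xs z))) eq)
  2+j≤c : suc (suc j) ≤ c
  2+j≤c = subst (suc (suc j) ≤_) eq′ (m≤n+m (suc (suc j)) (length xs))
  pos′ : All (0 <_) (y ∷ xs ++ z ∷ bs)
  pos′ = subst (λ l → All (0 <_) (y ∷ l)) (++-assoc xs [ z ] bs) pos
  0<yxs : All (0 <_) (y ∷ xs)
  0<yxs = All.++⁻ˡ (y ∷ xs) pos′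
  0<z : 0 < z
  0<z = All.head (All.++⁻ʳ (y ∷ xs) pos′)
  0<bs : All (0 <_) bs
  0<bs = All.tail (All.++⁻ʳ (y ∷ xs) pos′)

passes-weave : ∀ y xs → All (0 <_) (y ∷ xs) →
  passes (weave (suc (length xs)) 0 (y ∷ xs))
    ≡ length xs + passesAux (suc (suc (length xs))) 1 (y ∷ xs)
passes-weave y xs pos = begin
  passesAux (length π) 1 π
    ≡⟨ cong₂ (λ f l → passesAux f 1 l) fuel (sym (++-identityʳ π)) ⟩
  passesAux (m + suc (suc m)) 1 (π ++ shift (suc m) [])
    ≡⟨ passesAux-weave (reverseView xs) y [] (suc (suc m)) (+-comm m 1)
         (subst (λ l → All (0 <_) (y ∷ l)) (sym (++-identityʳ xs)) pos) ⟩
  m + passesAux (suc (suc m)) 1 (y ∷ xs ++ [])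
    ≡⟨ cong (λ l → m + passesAux (suc (suc m)) 1 (y ∷ l)) (++-identityʳ xs) ⟩
  m + passesAux (suc (suc m)) 1 (y ∷ xs) ∎
  where
  open ≡-Reasoning
  m : ℕ
  m = length xs
  π : List ℕ
  π = weave (suc m) 0 (y ∷ xs)
  fuel : length π ≡ m + suc (suc m)
  fuel = trans (length-weave (suc m) 0 (y ∷ xs)) (sym (+-suc m (suc m)))

tier-weave : ∀ σ → All (0 <_) σ → (length σ ∸ 1) + tier σ ≤ tier (weave (length σ) 0 σ)
tier-weave []       _   = z≤n
tier-weave (y ∷ xs) pos = begin
  m + (passes (y ∷ xs) ∸ 1)
    ≤⟨ +-monoʳ-≤ m (∸-monoˡ-≤ 1 (passesAux-mono-fuel (suc m) 1 (y ∷ xs))) ⟩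
  m + (N ∸ 1)
    ≡⟨ sym (+-∸-assoc m (s≤s z≤n)) ⟩
  (m + N) ∸ 1
    ≡⟨ cong (_∸ 1) (sym (passes-weave y xs pos)) ⟩
  tier (weave (suc m) 0 (y ∷ xs)) ∎
  where
  open ≤-Reasoning
  m : ℕ
  m = length xs
  N : ℕ
  N = passesAux (suc (suc m)) 1 (y ∷ xs)

∈-insertions⇒↭ : ∀ x zs {σ} → σ ∈ insertions x zs → σ ↭ x ∷ zs
∈-insertions⇒↭ x []       (here refl) = ↭-refl
∈-insertions⇒↭ x (y ∷ ys) (here refl) = ↭-refl
∈-insertions⇒↭ x (y ∷ ys) (there σ∈) with ∈-map⁻ (y ∷_) σ∈
... | ρ , ρ∈ , refl = ↭-trans (prep y (∈-insertions⇒↭ x ys ρ∈)) (swap y x ↭-refl)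

++-∈-insertions : ∀ x as bs → as ++ x ∷ bs ∈ insertions x (as ++ bs)
++-∈-insertions x []       []       = here refl
++-∈-insertions x []       (b ∷ bs) = here refl
++-∈-insertions x (a ∷ as) bs       = there (∈-map⁺ (a ∷_) (++-∈-insertions x as bs))

∈-perms⇒↭ : ∀ xs {σ} → σ ∈ perms xs → σ ↭ xs
∈-perms⇒↭ []       (here refl) = ↭-refl
∈-perms⇒↭ (x ∷ xs) σ∈ with find (∈-concatMap⁻ (insertions x) {xs = perms xs} σ∈)
... | ρ , ρ∈ , σ∈ins = ↭-trans (∈-insertions⇒↭ x ρ σ∈ins) (prep x (∈-perms⇒↭ xs ρ∈))

↭⇒∈-perms : ∀ xs {σ} → σ ↭ xs → σ ∈ perms xs
↭⇒∈-perms []       σ↭ with ↭.↭-empty-inv σ↭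
... | refl = here refl
↭⇒∈-perms (x ∷ xs) σ↭ with ∈-∃++ (↭.∈-resp-↭ (↭-sym σ↭) (here refl))
... | as , bs , refl = ∈-concatMap⁺ (insertions x) {xs = perms xs}
  (lose (↭⇒∈-perms xs (↭.drop-mid as [] σ↭)) (++-∈-insertions x as bs))

length-↭-oneTo : ∀ {k σ} → σ ↭ oneTo k → length σ ≡ k
length-↭-oneTo {k} σ↭ = trans (↭.↭-length σ↭) (trans (length-map suc (upTo k)) (length-upTo k))

oneTo-positive : ∀ k → All (0 <_) (oneTo k)
oneTo-positive k = All.map⁺ (All.universal (λ _ → s≤s z≤n) (upTo k))

oneTo-↭ : ∀ k → oneTo k ↭ applyDownFrom suc k
oneTo-↭ k = ↭-trans (↭-reflexive (map-upTo suc k))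
  (↭-trans (↭-sym (↭.↭-reverse _)) (↭-reflexive (reverse-applyUpTo suc k)))

applyDownFrom-suc-+ : ∀ m n →
  applyDownFrom suc (m + n) ≡ shift n (applyDownFrom suc m) ++ applyDownFrom suc n
applyDownFrom-suc-+ zero    n = refl
applyDownFrom-suc-+ (suc m) n =
  cong₂ _∷_ (trans (cong suc (+-comm m n)) (sym (+-suc n m))) (applyDownFrom-suc-+ m n)

weave-↭ : ∀ c j xs → weave c j xs ↭ shift c xs ++ shift j (applyDownFrom suc (length xs))
weave-↭ c j []       = ↭-refl
weave-↭ c j (x ∷ xs) = prep (c + x) (begin
  suc (length xs + j) ∷ weave c j xs
    <⟨ weave-↭ c j xs ⟩
  suc (length xs + j) ∷ shift c xs ++ D
    ≡⟨ cong (λ m → m ∷ shift c xs ++ D)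
            (trans (cong suc (+-comm (length xs) j)) (sym (+-suc j (length xs)))) ⟩
  j + suc (length xs) ∷ shift c xs ++ D
    ↭⟨ ↭-sym (↭.shift _ (shift c xs) D) ⟩
  shift c xs ++ j + suc (length xs) ∷ D ∎)
  where
  open PermutationReasoning
  D : List ℕ
  D = shift j (applyDownFrom suc (length xs))

weave-↭-oneTo : ∀ k {σ} → σ ↭ oneTo k → weave k 0 σ ↭ oneTo (2 * k)
weave-↭-oneTo k {σ} σ↭ = begin
  weave k 0 σ
    ↭⟨ weave-↭ k 0 σ ⟩
  shift k σ ++ shift 0 (applyDownFrom suc (length σ))
    ≡⟨ cong (shift k σ ++_) (trans (map-id _) (cong (applyDownFrom suc) (length-↭-oneTo σ↭))) ⟩
  shift k σ ++ applyDownFrom suc k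
    ↭⟨ ↭.++⁺ʳ _ (↭.map⁺ (k +_) (↭-trans σ↭ (oneTo-↭ k))) ⟩
  shift k (applyDownFrom suc k) ++ applyDownFrom suc k
    ≡⟨ sym (applyDownFrom-suc-+ k k) ⟩
  applyDownFrom suc (k + k)
    ↭⟨ ↭-sym (oneTo-↭ (k + k)) ⟩
  oneTo (k + k)
    ≡⟨ cong (λ m → oneTo (k + m)) (sym (+-identityʳ k)) ⟩
  oneTo (2 * k) ∎
  where open PermutationReasoning

tier-bound : ∀ k {σ} → σ ∈ Perms k → (k ∸ 1) + tier σ ≤ τ (2 * k)
tier-bound k {σ} σ∈ = ≤-trans
  (subst (λ m → (m ∸ 1) + tier σ ≤ tier (weave m 0 σ)) (length-↭-oneTo σ↭)
    (tier-weave σ (↭.All-resp-↭ (↭-sym σ↭) (oneTo-positive k))))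
  (All.lookup (xs≤max 0 (map tier (Perms (2 * k))))
    (∈-map⁺ tier (↭⇒∈-perms (oneTo (2 * k)) (weave-↭-oneTo k σ↭))))
  where
  σ↭ : σ ↭ oneTo k
  σ↭ = ∈-perms⇒↭ (oneTo k) σ∈

+-max≤ : ∀ {a v} xs → a ≤ v → All (λ x → a + x ≤ v) xs → a + max 0 xs ≤ v
+-max≤ {a} {v} xs a≤v a+xs≤v =
  ≤-trans (+-monoʳ-≤ a (max≤v⁺ z≤n (All.map ≤∸a a+xs≤v))) (≤-reflexive (m+[n∸m]≡n a≤v))
  where
  ≤∸a : ∀ {x} → a + x ≤ v → x ≤ v ∸ a
  ≤∸a {x} a+x≤v = m+n≤o⇒m≤o∸n x (subst (_≤ v) (+-comm a x) a+x≤v)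

lemma3p11 : (k : ℕ) → 1 ≤ k → τ (2 * k) ≥ (k ∸ 1) + τ k
lemma3p11 k _ = +-max≤ (map tier (Perms k))
  (≤-trans (m≤m+n (k ∸ 1) _) (tier-bound k (↭⇒∈-perms (oneTo k) ↭-refl)))
  (All.map⁺ (All.tabulate (tier-bound k)))
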